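{- $\vdash_{\mathsf{GT}^- }\Gamma\Rightarrow \Delta \iff \vdash_{\mathsf{GT}'^- }\Gamma\Rightarrow \Delta$.
   Context: Classical formulas: $\alpha::=p\mid\bot\mid\neg\alpha\mid\alpha\wedge\alpha\mid\alpha\vee\alpha$; formulas of $\mathbf{PL}(\mathbin{\backslash\!\!\!/})$: $\phi::=\alpha\mid\phi\wedge\phi\mid\phi\vee\phi\mid\phi\mathbin{\backslash\!\!\!/}\phi$ ($\vee$ split disjunction, $\mathbin{\backslash\!\!\!/}$ inquisitive disjunction). $\mathsf{GT}^-$ ($\alpha$ classical, $\Lambda$ a multiset of classical formulas) has axioms $\Gamma,p\Rightarrow p,\Delta$, $\Gamma,\bot\Rightarrow\Delta$ and rules $\mathsf{L}\neg$ ($\Gamma\Rightarrow\alpha,\Delta$ / $\Gamma,\neg\alpha\Rightarrow\Delta$), $\mathsf{R}\neg$ ($\Gamma,\alpha\Rightarrow\Delta$ / $\Gamma\Rightarrow\neg\alpha,\Delta$), $\mathsf{L}\wedge$ ($\Gamma,\phi,\psi\Rightarrow\Delta$ / $\Gamma,\phi\wedge\psi\Rightarrow\Delta$), $\mathsf{R}\wedge$ ($\Gamma\Rightarrow\phi,\Lambda$ and $\Gamma\Rightarrow\psi,\Lambda$ / $\Gamma\Rightarrow\phi\wedge\psi,\Lambda,\Delta$), $\mathsf{L}\vee$ ($\Gamma,\phi\Rightarrow\Lambda$ and $\Gamma,\psi\Rightarrow\Lambda$ / $\Gamma,\phi\vee\psi\Rightarrow\Lambda,\Delta$), $\mathsf{R}\vee$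 ($\Gamma\Rightarrow\phi,\psi,\Delta$ / $\Gamma\Rightarrow\phi\vee\psi,\Delta$), $\mathsf{L}\mathbin{\backslash\!\!\!/}$ ($\Gamma,\chi\{\phi_L\}\Rightarrow\Delta$ and $\Gamma,\chi\{\phi_R\}\Rightarrow\Delta$ / $\Gamma,\chi\{\phi_L\mathbin{\backslash\!\!\!/}\phi_R\}\Rightarrow\Delta$), $\mathsf{R}\mathbin{\backslash\!\!\!/}$ ($\Gamma\Rightarrow\chi\{\phi_i\},\Delta$ / $\Gamma\Rightarrow\chi\{\phi_L\mathbin{\backslash\!\!\!/}\phi_R\},\Delta$), where $\chi\{\eta\}$ replaces a fixed subformula occurrence of $\chi$ not in the scope of a negation by $\eta$ (no cut rule). $\mathsf{GT}'^-$ is obtained from $\mathsf{GT}^-$ by removing $\mathsf{R}\wedge$ and $\mathsf{L}\vee$ and adding the independent-context rules $\mathsf{L}\vee'$ (from $\Gamma_1,\phi\Rightarrow\Delta_1$ and $\Gamma_2,\psi\Rightarrow\Delta_2$ infer $\Gamma_1,\Gamma_2,\phi\vee\psi\Rightarrow\Delta_1,\Delta_2$) and $\mathsf{R}\wedge'$ (from $\Gamma_1\Rightarrow\phi,\Delta_1$ and $\Gamma_2\Rightarrow\psi,\Delta_2$ infer $\Gamma_1,\Gamma_2\Rightarrow\phi\wedge\psi,\Delta_1,\Delta_2$), together with left contraction $\mathsf{LC}$ (from $\Gamma,\phi,\phi\Rightarrow\Delta$ infer $\Gamma,\phi\Rightarrow\Delta$) and right contraction for classical formulas $\mathsf{RC}$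 (from $\Gamma\Rightarrow\alpha,\alpha,\Delta$ infer $\Gamma\Rightarrow\alpha,\Delta$). -}

module Defs where

open import Data.Nat using (ℕ)
open import Data.List using (List; []; _∷_; _++_)
open import Data.List.Relation.Unary.All using (All)
open import Data.List.Relation.Binary.Permutation.Propositional using (_↭_)

infixr 6 _∧_
infixr 5 _∨_ _⩔_

-- Negation is syntactically allowed on any formula, but the well-formedness
-- predicate WF below restricts it to classical arguments, as in the grammar.
data Form : Set where
  atom : ℕ → Form
  ⊥'   : Form
  ¬'   : Form → Form
  _∧_  : Form → Form → Form
  _∨_  : Form → Form → Form
  _⩔_  : Form → Form → Form

data Classical : Form → Set where
  c-atom : ∀ {p} → Classical (atom p)
  c-bot  : Classical ⊥'
  c-neg  : ∀ {α} → Classical α → Classical (¬' α)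
  c-and  : ∀ {α β} → Classical α → Classical β → Classical (α ∧ β)
  c-or   : ∀ {α β} → Classical α → Classical β → Classical (α ∨ β)

data WF : Form → Set where
  wf-cl  : ∀ {α} → Classical α → WF α
  wf-and : ∀ {φ ψ} → WF φ → WF ψ → WF (φ ∧ ψ)
  wf-or  : ∀ {φ ψ} → WF φ → WF ψ → WF (φ ∨ ψ)
  wf-inq : ∀ {φ ψ} → WF φ → WF ψ → WF (φ ⩔ ψ)

-- Contexts χ{·}: a formula with one hole, never in the scope of a negation.
data Ctx : Set where
  hole : Ctx
  ∧ˡ   : Ctx → Form → Ctx
  ∧ʳ   : Form → Ctx → Ctx
  ∨ˡ   : Ctx → Form → Ctx
  ∨ʳ   : Form → Ctx → Ctx
  ⩔ˡ   : Ctx → Form → Ctx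
  ⩔ʳ   : Form → Ctx → Ctx

plug : Ctx → Form → Form
plug hole     η = η
plug (∧ˡ C ψ) η = plug C η ∧ ψ
plug (∧ʳ φ C) η = φ ∧ plug C η
plug (∨ˡ C ψ) η = plug C η ∨ ψ
plug (∨ʳ φ C) η = φ ∨ plug C η
plug (⩔ˡ C ψ) η = plug C η ⩔ ψ
plug (⩔ʳ φ C) η = φ ⩔ plug C η

-- Sequents Γ ⇒ Δ: multisets are represented as lists, identified up to
-- permutation by the structural rule `perm` (present in both systems).

data GT : List Form → List Form → Set where
  perm : ∀ {Γ Γ' Δ Δ'} → Γ ↭ Γ' → Δ ↭ Δ' → GT Γ Δ → GT Γ' Δ'
  ax   : ∀ {Γ Δ p} → GT (atom p ∷ Γ) (atom p ∷ Δ)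
  ax⊥  : ∀ {Γ Δ} → GT (⊥' ∷ Γ) Δ
  L¬   : ∀ {Γ Δ α} → Classical α → GT Γ (α ∷ Δ) → GT (¬' α ∷ Γ) Δ
  R¬   : ∀ {Γ Δ α} → Classical α → GT (α ∷ Γ) Δ → GT Γ (¬' α ∷ Δ)
  L∧   : ∀ {Γ Δ φ ψ} → GT (φ ∷ ψ ∷ Γ) Δ → GT ((φ ∧ ψ) ∷ Γ) Δ
  R∧   : ∀ {Γ Λ Δ φ ψ} → All Classical Λ →
         GT Γ (φ ∷ Λ) → GT Γ (ψ ∷ Λ) → GT Γ ((φ ∧ ψ) ∷ Λ ++ Δ)
  L∨   : ∀ {Γ Λ Δ φ ψ} → All Classical Λ →
         GT (φ ∷ Γ) Λ → GT (ψ ∷ Γ) Λ → GT ((φ ∨ ψ) ∷ Γ) (Λ ++ Δ)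
  R∨   : ∀ {Γ Δ φ ψ} → GT Γ (φ ∷ ψ ∷ Δ) → GT Γ ((φ ∨ ψ) ∷ Δ)
  L⩔   : ∀ {Γ Δ} (χ : Ctx) {φL φR} →
         GT (plug χ φL ∷ Γ) Δ → GT (plug χ φR ∷ Γ) Δ →
         GT (plug χ (φL ⩔ φR) ∷ Γ) Δ
  R⩔ˡ  : ∀ {Γ Δ} (χ : Ctx) {φL φR} →
         GT Γ (plug χ φL ∷ Δ) → GT Γ (plug χ (φL ⩔ φR) ∷ Δ)
  R⩔ʳ  : ∀ {Γ Δ} (χ : Ctx) {φL φR} →
         GT Γ (plug χ φR ∷ Δ) → GT Γ (plug χ (φL ⩔ φR) ∷ Δ)

data GT' : List Form → List Form → Set where
  perm : ∀ {Γ Γ' Δ Δ'} → Γ ↭ Γ' → Δ ↭ Δ' → GT' Γ Δ → GT' Γ' Δ'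
  ax   : ∀ {Γ Δ p} → GT' (atom p ∷ Γ) (atom p ∷ Δ)
  ax⊥  : ∀ {Γ Δ} → GT' (⊥' ∷ Γ) Δ
  L¬   : ∀ {Γ Δ α} → Classical α → GT' Γ (α ∷ Δ) → GT' (¬' α ∷ Γ) Δ
  R¬   : ∀ {Γ Δ α} → Classical α → GT' (α ∷ Γ) Δ → GT' Γ (¬' α ∷ Δ)
  L∧   : ∀ {Γ Δ φ ψ} → GT' (φ ∷ ψ ∷ Γ) Δ → GT' ((φ ∧ ψ) ∷ Γ) Δ
  R∨   : ∀ {Γ Δ φ ψ} → GT' Γ (φ ∷ ψ ∷ Δ) → GT' Γ ((φ ∨ ψ) ∷ Δ)
  L⩔   : ∀ {Γ Δ} (χ : Ctx) {φL φR} →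
         GT' (plug χ φL ∷ Γ) Δ → GT' (plug χ φR ∷ Γ) Δ →
         GT' (plug χ (φL ⩔ φR) ∷ Γ) Δ
  R⩔ˡ  : ∀ {Γ Δ} (χ : Ctx) {φL φR} →
         GT' Γ (plug χ φL ∷ Δ) → GT' Γ (plug χ (φL ⩔ φR) ∷ Δ)
  R⩔ʳ  : ∀ {Γ Δ} (χ : Ctx) {φL φR} →
         GT' Γ (plug χ φR ∷ Δ) → GT' Γ (plug χ (φL ⩔ φR) ∷ Δ)
  L∨'  : ∀ {Γ₁ Γ₂ Δ₁ Δ₂ φ ψ} →
         GT' (φ ∷ Γ₁) Δ₁ → GT' (ψ ∷ Γ₂) Δ₂ →
         GT' ((φ ∨ ψ) ∷ Γ₁ ++ Γ₂) (Δ₁ ++ Δ₂)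
  R∧'  : ∀ {Γ₁ Γ₂ Δ₁ Δ₂ φ ψ} →
         GT' Γ₁ (φ ∷ Δ₁) → GT' Γ₂ (ψ ∷ Δ₂) →
         GT' (Γ₁ ++ Γ₂) ((φ ∧ ψ) ∷ Δ₁ ++ Δ₂)
  LC   : ∀ {Γ Δ φ} → GT' (φ ∷ φ ∷ Γ) Δ → GT' (φ ∷ Γ) Δ
  RC   : ∀ {Γ Δ α} → Classical α → GT' Γ (α ∷ α ∷ Δ) → GT' Γ (α ∷ Δ)

{-# OPTIONS --safe #-}
module Submission where

-- GT⁻ ⊆ GT'⁻: the shared-context rules R∧ and L∨ are the independent-context rules
-- followed by contracting the duplicated context (on the right only the classical Λ is
-- duplicated, so RC suffices) and weakening, which is admissible in GT'⁻.
--
-- GT'⁻ ⊆ GT⁻ goes through semantics. A resolution of a formula picks one disjunct of every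
-- ⩔ not under ¬; resolutions of well-formed formulas are classical. Every rule of GT'⁻
-- preserves inquisitive validity: for each resolution γ of Γ some resolution δ of Δ makes
-- γ ⇒ δ classically valid. Valid classical sequents are derivable in GT⁻ by invertible
-- proof search, where R∧ and L∨ apply because the whole context is classical. Finally
-- L⩔ glues the derivations of γ ⇒ Δ over all resolutions γ of Γ, and R⩔ lifts δ to Δ.

open import Defs
open import Data.Bool using (Bool; true; false; not; T) renaming (_∧_ to _&&_; _∨_ to _||_)
open import Data.Bool.Properties using (T-∧; T-∨)
open import Data.Empty using (⊥-elim)
open import Data.List using (List; []; _∷_; _++_; [_]; map)
open import Data.List.Properties using (++-assoc; ++-identityʳ)
open import Data.List.Membership.Propositional using (_∈_)
open import Data.List.Membership.Propositional.Properties using (∈-map⁺; ∈-∃++)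
open import Data.List.Relation.Binary.Permutation.Propositional
  using (_↭_; refl; prep; swap; trans; ↭-refl; ↭-sym; ↭-trans; ↭-prep; ↭-swap; ↭-reflexive)
open import Data.List.Relation.Binary.Permutation.Propositional.Properties
  using (shift; ++⁺ˡ; ++⁺ʳ; All-resp-↭; Any-resp-↭)
open import Data.List.Relation.Binary.Pointwise as Pointwise using (Pointwise; []; _∷_)
open import Data.List.Relation.Unary.All as All using (All; []; _∷_)
open import Data.List.Relation.Unary.All.Properties as All using ()
open import Data.List.Relation.Unary.Any using (Any; here; there)
import Data.List.Relation.Unary.Any.Properties as Any
open import Data.Nat using (ℕ)
open import Data.Nat.Properties using (_≟_)
open import Data.List.Membership.DecPropositional _≟_ using (_∈?_)
open import Data.Product using (∃; ∃₂; _×_; _,_; -,_; proj₁; proj₂)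
open import Data.Sum as Sum using (_⊎_; inj₁; inj₂; [_,_]′)
open import Function using (_∘_)
open import Function.Bundles using (_⇔_; mk⇔; module Equivalence)
open Equivalence using (to; from)
open import Relation.Binary.PropositionalEquality using (_≡_; refl; sym; cong₂; subst; subst₂)
open import Relation.Nullary using (¬_; yes; no)
open import Relation.Nullary.Decidable using (T?; isYes; toWitness; fromWitness)
open import Relation.Unary using (_⊆_; _∪_)

weakenʳ : ∀ {Γ Δ} Θ → GT' Γ Δ → GT' Γ (Δ ++ Θ)
weakenʳ Θ (perm p q d) = perm p (++⁺ʳ Θ q) (weakenʳ Θ d)
weakenʳ Θ ax           = ax
weakenʳ Θ ax⊥          = ax⊥
weakenʳ Θ (L¬ c d)     = L¬ c (weakenʳ Θ d)
weakenʳ Θ (R¬ c d)     = R¬ c (weakenʳ Θ d)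
weakenʳ Θ (L∧ d)       = L∧ (weakenʳ Θ d)
weakenʳ Θ (R∨ d)       = R∨ (weakenʳ Θ d)
weakenʳ Θ (L⩔ χ d e)   = L⩔ χ (weakenʳ Θ d) (weakenʳ Θ e)
weakenʳ Θ (R⩔ˡ χ d)    = R⩔ˡ χ (weakenʳ Θ d)
weakenʳ Θ (R⩔ʳ χ d)    = R⩔ʳ χ (weakenʳ Θ d)
weakenʳ Θ (LC d)       = LC (weakenʳ Θ d)
weakenʳ Θ (RC c d)     = RC c (weakenʳ Θ d)
weakenʳ Θ (L∨' {Δ₁ = Δ₁} {Δ₂} d e) =
  perm ↭-refl (↭-reflexive (sym (++-assoc Δ₁ Δ₂ Θ))) (L∨' d (weakenʳ Θ e))
weakenʳ Θ (R∧' {Δ₁ = Δ₁} {Δ₂} d e) =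
  perm ↭-refl (↭-prep _ (↭-reflexive (sym (++-assoc Δ₁ Δ₂ Θ)))) (R∧' d (weakenʳ Θ e))

duplicate-↭ : ∀ (x : Form) Θ Γ → Θ ++ x ∷ Γ ++ x ∷ Γ ↭ x ∷ x ∷ Θ ++ Γ ++ Γ
duplicate-↭ x Θ Γ =
  ↭-trans (shift x Θ _) (↭-prep x (↭-trans (++⁺ˡ Θ (shift x Γ Γ)) (shift x Θ _)))

contractˡ : ∀ {Δ} Θ Γ → GT' (Θ ++ Γ ++ Γ) Δ → GT' (Θ ++ Γ) Δ
contractˡ Θ []      d = d
contractˡ Θ (x ∷ Γ) d =
  perm (↭-sym (shift x Θ Γ)) ↭-refl
    (contractˡ (x ∷ Θ) Γ (LC (perm (duplicate-↭ x Θ Γ) ↭-refl d)))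

contractʳ : ∀ {Γ} Θ Λ → All Classical Λ → GT' Γ (Θ ++ Λ ++ Λ) → GT' Γ (Θ ++ Λ)
contractʳ Θ []      []       d = d
contractʳ Θ (x ∷ Λ) (c ∷ cs) d =
  perm ↭-refl (↭-sym (shift x Θ Λ))
    (contractʳ (x ∷ Θ) Λ cs (RC c (perm ↭-refl (duplicate-↭ x Θ Λ) d)))

R∧-admissible : ∀ {Γ Λ Δ φ ψ} → All Classical Λ →
                GT' Γ (φ ∷ Λ) → GT' Γ (ψ ∷ Λ) → GT' Γ ((φ ∧ ψ) ∷ Λ ++ Δ)
R∧-admissible {Γ} {Λ} {Δ} cs d e =
  weakenʳ Δ (contractʳ [ _ ] Λ cs (contractˡ [] Γ (R∧' d e)))

L∨-admissible : ∀ {Γ Λ Δ φ ψ} → All Classical Λ →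
                GT' (φ ∷ Γ) Λ → GT' (ψ ∷ Γ) Λ → GT' ((φ ∨ ψ) ∷ Γ) (Λ ++ Δ)
L∨-admissible {Γ} {Λ} {Δ} cs d e =
  weakenʳ Δ (contractʳ [] Λ cs (contractˡ [ _ ] Γ (L∨' d e)))

GT⇒GT' : ∀ {Γ Δ} → GT Γ Δ → GT' Γ Δ
GT⇒GT' (perm p q d) = perm p q (GT⇒GT' d)
GT⇒GT' ax           = ax
GT⇒GT' ax⊥          = ax⊥
GT⇒GT' (L¬ c d)     = L¬ c (GT⇒GT' d)
GT⇒GT' (R¬ c d)     = R¬ c (GT⇒GT' d)
GT⇒GT' (L∧ d)       = L∧ (GT⇒GT' d)
GT⇒GT' (R∧ cs d e)  = R∧-admissible cs (GT⇒GT' d) (GT⇒GT' e)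
GT⇒GT' (L∨ cs d e)  = L∨-admissible cs (GT⇒GT' d) (GT⇒GT' e)
GT⇒GT' (R∨ d)       = R∨ (GT⇒GT' d)
GT⇒GT' (L⩔ χ d e)   = L⩔ χ (GT⇒GT' d) (GT⇒GT' e)
GT⇒GT' (R⩔ˡ χ d)    = R⩔ˡ χ (GT⇒GT' d)
GT⇒GT' (R⩔ʳ χ d)    = R⩔ʳ χ (GT⇒GT' d)

Valuation : Set
Valuation = ℕ → Bool

-- The ⩔ clause is arbitrary: only resolutions, which are ⩔-free, get evaluated.
eval : Valuation → Form → Bool
eval v (atom p) = v p
eval v ⊥'       = false
eval v (¬' φ)   = not (eval v φ)
eval v (φ ∧ ψ)  = eval v φ && eval v ψ
eval v (φ ∨ ψ)  = eval v φ || eval v ψ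
eval v (φ ⩔ ψ)  = eval v φ || eval v ψ

_⊨_ : Valuation → Form → Set
v ⊨ φ = T (eval v φ)

Valid : List Form → List Form → Set
Valid γ δ = ∀ v → All (v ⊨_) γ → Any (v ⊨_) δ

¬T⇒T-not : ∀ {b} → ¬ T b → T (not b)
¬T⇒T-not {false} _  = _
¬T⇒T-not {true}  ¬t = ¬t _

T-not⇒¬T : ∀ {b} → T (not b) → ¬ T b
T-not⇒¬T {false} _ ()

valid-perm : ∀ {γ γ' δ δ'} → γ ↭ γ' → δ ↭ δ' → Valid γ δ → Valid γ' δ'
valid-perm p q h v vγ' = Any-resp-↭ q (h v (All-resp-↭ (↭-sym p) vγ'))

valid-ax : ∀ {p γ δ} → Valid (atom p ∷ γ) (atom p ∷ δ)
valid-ax v (t ∷ _) = here t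

valid-ax⊥ : ∀ {γ δ} → Valid (⊥' ∷ γ) δ
valid-ax⊥ v (() ∷ _)

valid-L¬ : ∀ {φ γ δ} → Valid (¬' φ ∷ γ) δ ⇔ Valid γ (φ ∷ δ)
valid-L¬ {φ} = mk⇔ inversion rule
  where
  inversion : ∀ {γ δ} → Valid (¬' φ ∷ γ) δ → Valid γ (φ ∷ δ)
  inversion h v ts with T? (eval v φ)
  ... | yes t = here t
  ... | no ¬t = there (h v (¬T⇒T-not ¬t ∷ ts))
  rule : ∀ {γ δ} → Valid γ (φ ∷ δ) → Valid (¬' φ ∷ γ) δ
  rule h v (t ∷ ts) with h v ts
  ... | here s  = ⊥-elim (T-not⇒¬T t s)
  ... | there s = s

valid-R¬ : ∀ {φ γ δ} → Valid γ (¬' φ ∷ δ) ⇔ Valid (φ ∷ γ) δ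
valid-R¬ {φ} = mk⇔ inversion rule
  where
  inversion : ∀ {γ δ} → Valid γ (¬' φ ∷ δ) → Valid (φ ∷ γ) δ
  inversion h v (t ∷ ts) with h v ts
  ... | here s  = ⊥-elim (T-not⇒¬T s t)
  ... | there s = s
  rule : ∀ {γ δ} → Valid (φ ∷ γ) δ → Valid γ (¬' φ ∷ δ)
  rule h v ts with T? (eval v φ)
  ... | yes t = there (h v (t ∷ ts))
  ... | no ¬t = here (¬T⇒T-not ¬t)

valid-L∧ : ∀ {φ ψ γ δ} → Valid ((φ ∧ ψ) ∷ γ) δ ⇔ Valid (φ ∷ ψ ∷ γ) δ
valid-L∧ = mk⇔ (λ h v → λ { (s ∷ t ∷ ts) → h v (from T-∧ (s , t) ∷ ts) })
               (λ h v → λ { (st ∷ ts) → let (s , t) = to T-∧ st in h v (s ∷ t ∷ ts) })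

valid-R∨ : ∀ {φ ψ γ δ} → Valid γ ((φ ∨ ψ) ∷ δ) ⇔ Valid γ (φ ∷ ψ ∷ δ)
valid-R∨ = mk⇔ inversion rule
  where
  inversion : ∀ {φ ψ γ δ} → Valid γ ((φ ∨ ψ) ∷ δ) → Valid γ (φ ∷ ψ ∷ δ)
  inversion h v ts with h v ts
  ... | here st  = [ here , there ∘ here ]′ (to T-∨ st)
  ... | there s  = there (there s)
  rule : ∀ {φ ψ γ δ} → Valid γ (φ ∷ ψ ∷ δ) → Valid γ ((φ ∨ ψ) ∷ δ)
  rule h v ts with h v ts
  ... | here s          = here (from T-∨ (inj₁ s))
  ... | there (here t)  = here (from T-∨ (inj₂ t))
  ... | there (there s) = there s

valid-L∨ : ∀ {φ ψ γ δ} → Valid ((φ ∨ ψ) ∷ γ) δ → Valid (φ ∷ γ) δ × Valid (ψ ∷ γ) δ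
valid-L∨ h = (λ v → λ { (s ∷ ts) → h v (from T-∨ (inj₁ s) ∷ ts) })
           , (λ v → λ { (t ∷ ts) → h v (from T-∨ (inj₂ t) ∷ ts) })

valid-R∧ : ∀ {φ ψ γ δ} → Valid γ ((φ ∧ ψ) ∷ δ) → Valid γ (φ ∷ δ) × Valid γ (ψ ∷ δ)
valid-R∧ {φ} {ψ} {γ} {δ} h = (λ v ts → [ here ∘ proj₁ , there ]′ (split v ts))
                           , (λ v ts → [ here ∘ proj₂ , there ]′ (split v ts))
  where
  split : ∀ v → All (v ⊨_) γ → (v ⊨ φ × v ⊨ ψ) ⊎ Any (v ⊨_) δ
  split v ts with h v ts
  ... | here st = inj₁ (to T-∧ st)
  ... | there s = inj₂ s

valid-L∨' : ∀ {φ ψ γ₁ γ₂ δ₁ δ₂} → Valid (φ ∷ γ₁) δ₁ → Valid (ψ ∷ γ₂) δ₂ →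
            Valid ((φ ∨ ψ) ∷ γ₁ ++ γ₂) (δ₁ ++ δ₂)
valid-L∨' {γ₁ = γ₁} {δ₁ = δ₁} h k v (st ∷ ts)
  with to T-∨ st | All.++⁻ γ₁ ts
... | inj₁ s | ts₁ , _   = Any.++⁺ˡ (h v (s ∷ ts₁))
... | inj₂ t | _   , ts₂ = Any.++⁺ʳ δ₁ (k v (t ∷ ts₂))

valid-R∧' : ∀ {φ ψ γ₁ γ₂ δ₁ δ₂} → Valid γ₁ (φ ∷ δ₁) → Valid γ₂ (ψ ∷ δ₂) →
            Valid (γ₁ ++ γ₂) ((φ ∧ ψ) ∷ δ₁ ++ δ₂)
valid-R∧' {γ₁ = γ₁} {δ₁ = δ₁} h k v ts
  with All.++⁻ γ₁ ts
... | ts₁ , ts₂ with h v ts₁ | k v ts₂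
...   | there s | _       = there (Any.++⁺ˡ s)
...   | here _  | there t = there (Any.++⁺ʳ δ₁ t)
...   | here s  | here t  = here (from T-∧ (s , t))

valid-LC : ∀ {φ γ δ} → Valid (φ ∷ φ ∷ γ) δ → Valid (φ ∷ γ) δ
valid-LC h v (t ∷ ts) = h v (t ∷ t ∷ ts)

valid-RC : ∀ {φ γ δ} → Valid γ (φ ∷ φ ∷ δ) → Valid γ (φ ∷ δ)
valid-RC h v ts with h v ts
... | here t  = here t
... | there s = s

-- Negations resolve to themselves: the ⩔-rules never act under ¬.
data Resolution : Form → Form → Set where
  res-atom : ∀ p → Resolution (atom p) (atom p)
  res-⊥    : Resolution ⊥' ⊥'
  res-¬    : ∀ φ → Resolution (¬' φ) (¬' φ)
  res-∧    : ∀ {φ ψ a b} → Resolution φ a → Resolution ψ b → Resolution (φ ∧ ψ) (a ∧ b)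
  res-∨    : ∀ {φ ψ a b} → Resolution φ a → Resolution ψ b → Resolution (φ ∨ ψ) (a ∨ b)
  res-⩔ˡ   : ∀ {φ ψ a} → Resolution φ a → Resolution (φ ⩔ ψ) a
  res-⩔ʳ   : ∀ {φ ψ a} → Resolution ψ a → Resolution (φ ⩔ ψ) a

Resolutions : List Form → List Form → Set
Resolutions = Pointwise Resolution

resolution : ∀ φ → ∃ (Resolution φ)
resolution (atom p) = -, res-atom p
resolution ⊥'       = -, res-⊥
resolution (¬' φ)   = -, res-¬ φ
resolution (φ ∧ ψ)  = -, res-∧ (proj₂ (resolution φ)) (proj₂ (resolution ψ))
resolution (φ ∨ ψ)  = -, res-∨ (proj₂ (resolution φ)) (proj₂ (resolution ψ))
resolution (φ ⩔ ψ)  = -, res-⩔ˡ (proj₂ (resolution φ))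

resolutions : ∀ Γ → ∃ (Resolutions Γ)
resolutions []      = -, []
resolutions (φ ∷ Γ) = -, proj₂ (resolution φ) ∷ proj₂ (resolutions Γ)

resolution-self : ∀ {α} → Classical α → Resolution α α
resolution-self c-atom      = res-atom _
resolution-self c-bot       = res-⊥
resolution-self (c-neg c)   = res-¬ _
resolution-self (c-and c d) = res-∧ (resolution-self c) (resolution-self d)
resolution-self (c-or c d)  = res-∨ (resolution-self c) (resolution-self d)

resolution-unique : ∀ {α a} → Classical α → Resolution α a → a ≡ α
resolution-unique c-atom      (res-atom p) = refl
resolution-unique c-bot       res-⊥        = refl
resolution-unique (c-neg c)   (res-¬ _)    = refl
resolution-unique (c-and c d) (res-∧ r s)  =
  cong₂ _∧_ (resolution-unique c r) (resolution-unique d s)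
resolution-unique (c-or c d)  (res-∨ r s)  =
  cong₂ _∨_ (resolution-unique c r) (resolution-unique d s)

resolution-classical : ∀ {φ a} → WF φ → Resolution φ a → Classical a
resolution-classical (wf-cl c)     r           = subst Classical (sym (resolution-unique c r)) c
resolution-classical (wf-and w w') (res-∧ r s) =
  c-and (resolution-classical w r) (resolution-classical w' s)
resolution-classical (wf-or w w')  (res-∨ r s) =
  c-or (resolution-classical w r) (resolution-classical w' s)
resolution-classical (wf-inq w _)  (res-⩔ˡ r)  = resolution-classical w r
resolution-classical (wf-inq _ w)  (res-⩔ʳ r)  = resolution-classical w r

resolutions-classical : ∀ {Γ γ} → All WF Γ → Resolutions Γ γ → All Classical γ
resolutions-classical []       []       = []
resolutions-classical (w ∷ ws) (r ∷ rs) =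
  resolution-classical w r ∷ resolutions-classical ws rs

resolution-plug-map : ∀ χ {η η'} → Resolution η ⊆ Resolution η' →
                      Resolution (plug χ η) ⊆ Resolution (plug χ η')
resolution-plug-map hole     f r            = f r
resolution-plug-map (∧ˡ χ _) f (res-∧ r s)  = res-∧ (resolution-plug-map χ f r) s
resolution-plug-map (∧ʳ _ χ) f (res-∧ r s)  = res-∧ r (resolution-plug-map χ f s)
resolution-plug-map (∨ˡ χ _) f (res-∨ r s)  = res-∨ (resolution-plug-map χ f r) s
resolution-plug-map (∨ʳ _ χ) f (res-∨ r s)  = res-∨ r (resolution-plug-map χ f s)
resolution-plug-map (⩔ˡ χ _) f (res-⩔ˡ r)   = res-⩔ˡ (resolution-plug-map χ f r)
resolution-plug-map (⩔ˡ χ _) f (res-⩔ʳ r)   = res-⩔ʳ r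
resolution-plug-map (⩔ʳ _ χ) f (res-⩔ˡ r)   = res-⩔ˡ r
resolution-plug-map (⩔ʳ _ χ) f (res-⩔ʳ r)   = res-⩔ʳ (resolution-plug-map χ f r)

resolution-plug-split : ∀ χ {η φ ψ} → Resolution η ⊆ Resolution φ ∪ Resolution ψ →
                        Resolution (plug χ η) ⊆ Resolution (plug χ φ) ∪ Resolution (plug χ ψ)
resolution-plug-split hole     f r           = f r
resolution-plug-split (∧ˡ χ _) f (res-∧ r s) =
  Sum.map (λ r' → res-∧ r' s) (λ r' → res-∧ r' s) (resolution-plug-split χ f r)
resolution-plug-split (∧ʳ _ χ) f (res-∧ r s) =
  Sum.map (res-∧ r) (res-∧ r) (resolution-plug-split χ f s)
resolution-plug-split (∨ˡ χ _) f (res-∨ r s) =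
  Sum.map (λ r' → res-∨ r' s) (λ r' → res-∨ r' s) (resolution-plug-split χ f r)
resolution-plug-split (∨ʳ _ χ) f (res-∨ r s) =
  Sum.map (res-∨ r) (res-∨ r) (resolution-plug-split χ f s)
resolution-plug-split (⩔ˡ χ _) f (res-⩔ˡ r)  =
  Sum.map res-⩔ˡ res-⩔ˡ (resolution-plug-split χ f r)
resolution-plug-split (⩔ˡ χ _) f (res-⩔ʳ r)  = inj₁ (res-⩔ʳ r)
resolution-plug-split (⩔ʳ _ χ) f (res-⩔ˡ r)  = inj₁ (res-⩔ˡ r)
resolution-plug-split (⩔ʳ _ χ) f (res-⩔ʳ r)  =
  Sum.map res-⩔ʳ res-⩔ʳ (resolution-plug-split χ f r)

resolution-⩔ : ∀ {φ ψ} → Resolution (φ ⩔ ψ) ⊆ Resolution φ ∪ Resolution ψ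
resolution-⩔ (res-⩔ˡ r) = inj₁ r
resolution-⩔ (res-⩔ʳ r) = inj₂ r

Pointwise-++⁻ : ∀ {A B : Set} {R : A → B → Set} xs₁ {xs₂ ys} →
                Pointwise R (xs₁ ++ xs₂) ys →
                ∃₂ λ ys₁ ys₂ → ys ≡ ys₁ ++ ys₂ × Pointwise R xs₁ ys₁ × Pointwise R xs₂ ys₂
Pointwise-++⁻ []        rs       = [] , _ , refl , [] , rs
Pointwise-++⁻ (x ∷ xs₁) (r ∷ rs) with Pointwise-++⁻ xs₁ rs
... | ys₁ , ys₂ , refl , rs₁ , rs₂ = _ ∷ ys₁ , ys₂ , refl , r ∷ rs₁ , rs₂

Pointwise-↭ˡ : ∀ {A B : Set} {R : A → B → Set} {xs xs' ys} →
               xs ↭ xs' → Pointwise R xs ys → ∃ λ ys' → Pointwise R xs' ys' × ys ↭ ys'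
Pointwise-↭ˡ refl rs = -, rs , ↭-refl
Pointwise-↭ˡ (prep x p) (r ∷ rs) =
  let (_ , rs' , q) = Pointwise-↭ˡ p rs in -, r ∷ rs' , ↭-prep _ q
Pointwise-↭ˡ (swap x y p) (r ∷ s ∷ rs) =
  let (_ , rs' , q) = Pointwise-↭ˡ p rs in -, s ∷ r ∷ rs' , ↭-swap _ _ q
Pointwise-↭ˡ (trans p p') rs =
  let (_ , rs₁ , q₁) = Pointwise-↭ˡ p rs
      (_ , rs₂ , q₂) = Pointwise-↭ˡ p' rs₁
  in -, rs₂ , ↭-trans q₁ q₂

InqValid : List Form → List Form → Set
InqValid Γ Δ = ∀ {γ} → Resolutions Γ γ → ∃ λ δ → Resolutions Δ δ × Valid γ δ

GT'-sound : ∀ {Γ Δ} → GT' Γ Δ → InqValid Γ Δ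
GT'-sound (perm p q d) rs' =
  let (_ , rs , p')  = Pointwise-↭ˡ (↭-sym p) rs'
      (_ , rd , h)   = GT'-sound d rs
      (_ , rd' , q') = Pointwise-↭ˡ q rd
  in -, rd' , valid-perm (↭-sym p') q' h
GT'-sound {Δ = _ ∷ Δ} ax (res-atom p ∷ _) = -, res-atom p ∷ proj₂ (resolutions Δ) , valid-ax
GT'-sound {Δ = Δ} ax⊥ (res-⊥ ∷ _) = -, proj₂ (resolutions Δ) , valid-ax⊥
GT'-sound (L¬ c d) (res-¬ _ ∷ rs) with GT'-sound d rs
... | _ , r ∷ rd , h with refl ← resolution-unique c r =
  -, rd , from valid-L¬ h
GT'-sound (R¬ c d) rs =
  let (_ , rd , h) = GT'-sound d (resolution-self c ∷ rs)
  in -, res-¬ _ ∷ rd , from valid-R¬ h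
GT'-sound (L∧ d) (res-∧ r s ∷ rs) =
  let (_ , rd , h) = GT'-sound d (r ∷ s ∷ rs)
  in -, rd , from valid-L∧ h
GT'-sound (R∨ d) rs with GT'-sound d rs
... | _ , r ∷ s ∷ rd , h = -, res-∨ r s ∷ rd , from valid-R∨ h
GT'-sound (L⩔ χ d e) (r ∷ rs) with resolution-plug-split χ resolution-⩔ r
... | inj₁ r' = GT'-sound d (r' ∷ rs)
... | inj₂ r' = GT'-sound e (r' ∷ rs)
GT'-sound (R⩔ˡ χ d) rs with GT'-sound d rs
... | _ , r ∷ rd , h = -, resolution-plug-map χ res-⩔ˡ r ∷ rd , h
GT'-sound (R⩔ʳ χ d) rs with GT'-sound d rs
... | _ , r ∷ rd , h = -, resolution-plug-map χ res-⩔ʳ r ∷ rd , h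
GT'-sound (L∨' {Γ₁} d e) (res-∨ r s ∷ rs) with Pointwise-++⁻ Γ₁ rs
... | _ , _ , refl , rs₁ , rs₂ =
  let (_ , rd₁ , h) = GT'-sound d (r ∷ rs₁)
      (_ , rd₂ , k) = GT'-sound e (s ∷ rs₂)
  in -, Pointwise.++⁺ rd₁ rd₂ , valid-L∨' h k
GT'-sound (R∧' {Γ₁} d e) rs with Pointwise-++⁻ Γ₁ rs
... | _ , _ , refl , rs₁ , rs₂ with GT'-sound d rs₁ | GT'-sound e rs₂
...   | _ , r ∷ rd₁ , h | _ , s ∷ rd₂ , k =
  -, res-∧ r s ∷ Pointwise.++⁺ rd₁ rd₂ , valid-R∧' h k
GT'-sound (LC d) (r ∷ rs) =
  let (_ , rd , h) = GT'-sound d (r ∷ r ∷ rs)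
  in -, rd , valid-LC h
GT'-sound (RC c d) rs with GT'-sound d rs
... | _ , r ∷ s ∷ rd , h with refl ← resolution-unique c r | refl ← resolution-unique c s =
  -, r ∷ rd , valid-RC h

R∧₀ : ∀ {Γ Λ φ ψ} → All Classical Λ →
      GT Γ (φ ∷ Λ) → GT Γ (ψ ∷ Λ) → GT Γ ((φ ∧ ψ) ∷ Λ)
R∧₀ {Λ = Λ} cs d e = subst (λ Δ → GT _ (_ ∷ Δ)) (++-identityʳ Λ) (R∧ cs d e)

L∨₀ : ∀ {Γ Λ φ ψ} → All Classical Λ →
      GT (φ ∷ Γ) Λ → GT (ψ ∷ Γ) Λ → GT ((φ ∨ ψ) ∷ Γ) Λ
L∨₀ {Λ = Λ} cs d e = subst (GT _) (++-identityʳ Λ) (L∨ cs d e)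

ax-∈ : ∀ {p Γ Δ} → atom p ∈ Γ → atom p ∈ Δ → GT Γ Δ
ax-∈ i j with ∈-∃++ i | ∈-∃++ j
... | Γ₁ , Γ₂ , refl | Δ₁ , Δ₂ , refl =
  perm (↭-sym (shift _ Γ₁ Γ₂)) (↭-sym (shift _ Δ₁ Δ₂)) ax

data Atomic : Form → Set where
  atom-atomic : ∀ p → Atomic (atom p)
  ⊥-atomic    : Atomic ⊥'

atomic-classical : ∀ {a} → Atomic a → Classical a
atomic-classical (atom-atomic p) = c-atom
atomic-classical ⊥-atomic        = c-bot

true-atom : ∀ {v δ} → All Atomic δ → Any (v ⊨_) δ → ∃ λ p → v ⊨ atom p × atom p ∈ δ
true-atom (atom-atomic p ∷ _) (here t)  = p , t , here refl
true-atom (_ ∷ as)            (there s) = let (p , t , i) = true-atom as s in p , t , there i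

-- Atoms decomposed on the left are kept as indices As, so that the countermodel
-- "p is true iff p ∈ As" is decidable.
Complete : List Form → List Form → Set
Complete Γ Δ = ∀ As {Bs} → All Atomic Bs →
               Valid (Γ ++ map atom As) (Δ ++ Bs) → GT (Γ ++ map atom As) (Δ ++ Bs)

complete-atomic : Complete [] []
complete-atomic As bs h =
  let (p , t , i) = true-atom bs (h v (All.map⁺ (All.tabulate fromWitness)))
  in ax-∈ (∈-map⁺ atom (toWitness t)) i
  where
  v : Valuation
  v p = isYes (p ∈? As)

complete-R-atomic : ∀ {α Γ Δ} → Atomic α → Complete Γ Δ → Complete Γ (α ∷ Δ)
complete-R-atomic {Δ = Δ} a k As bs h =
  perm ↭-refl (shift _ Δ _) (k As (a ∷ bs) (valid-perm ↭-refl (↭-sym (shift _ Δ _)) h))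

mutual
  complete-L : ∀ {α Γ Δ} → Classical α → All Classical Δ →
               Complete Γ Δ → Complete (α ∷ Γ) Δ
  complete-L {Γ = Γ} (c-atom {p}) cΔ k As bs h =
    perm (shift _ Γ _) ↭-refl (k (p ∷ As) bs (valid-perm (↭-sym (shift _ Γ _)) ↭-refl h))
  complete-L c-bot cΔ k As bs h = ax⊥
  complete-L (c-neg c) cΔ k As bs h =
    L¬ c (complete-R c cΔ k As bs (to valid-L¬ h))
  complete-L (c-and c d) cΔ k As bs h =
    L∧ (complete-L c cΔ (complete-L d cΔ k) As bs (to valid-L∧ h))
  complete-L (c-or c d) cΔ k As bs h =
    let (h₁ , h₂) = valid-L∨ h
    in L∨₀ (All.++⁺ cΔ (All.map atomic-classical bs))
           (complete-L c cΔ k As bs h₁) (complete-L d cΔ k As bs h₂)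

  complete-R : ∀ {α Γ Δ} → Classical α → All Classical Δ →
               Complete Γ Δ → Complete Γ (α ∷ Δ)
  complete-R c-atom cΔ k = complete-R-atomic (atom-atomic _) k
  complete-R c-bot  cΔ k = complete-R-atomic ⊥-atomic k
  complete-R (c-neg c) cΔ k As bs h =
    R¬ c (complete-L c cΔ k As bs (to valid-R¬ h))
  complete-R (c-and c d) cΔ k As bs h =
    let (h₁ , h₂) = valid-R∧ h
    in R∧₀ (All.++⁺ cΔ (All.map atomic-classical bs))
           (complete-R c cΔ k As bs h₁) (complete-R d cΔ k As bs h₂)
  complete-R (c-or c d) cΔ k As bs h =
    R∨ (complete-R c (d ∷ cΔ) (complete-R d cΔ k) As bs (to valid-R∨ h))

complete-classical : ∀ {Γ Δ} → All Classical Γ → All Classical Δ → Complete Γ Δ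
complete-classical []       []       = complete-atomic
complete-classical []       (c ∷ cs) = complete-R c cs (complete-classical [] cs)
complete-classical (c ∷ cs) cΔ       = complete-L c cΔ (complete-classical cs cΔ)

GT-complete : ∀ {γ δ} → All Classical γ → All Classical δ → Valid γ δ → GT γ δ
GT-complete {γ} {δ} cγ cδ h =
  subst₂ GT (++-identityʳ γ) (++-identityʳ δ)
    (complete-classical cγ cδ [] []
      (subst₂ Valid (sym (++-identityʳ γ)) (sym (++-identityʳ δ)) h))

-- Contexts are built from the outside in (plug (∧ˡ χ ψ) η = plug χ η ∧ ψ holds by definition),
-- so resolve-all and resolve-some descend into φ by changing the predicate, not the context.
⩔-Closedˡ : (Form → Set) → Set
⩔-Closedˡ P = ∀ χ {φ ψ} → P (plug χ φ) → P (plug χ ψ) → P (plug χ (φ ⩔ ψ))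

⩔-Closedʳ : (Form → Set) → Set
⩔-Closedʳ P = ∀ χ {φ ψ} →
  (P (plug χ φ) → P (plug χ (φ ⩔ ψ))) × (P (plug χ ψ) → P (plug χ (φ ⩔ ψ)))

resolve-all : ∀ {P} → ⩔-Closedˡ P → ∀ φ → (∀ {a} → Resolution φ a → P a) → P φ
resolve-all cl (atom p) f = f (res-atom p)
resolve-all cl ⊥'       f = f res-⊥
resolve-all cl (¬' φ)   f = f (res-¬ φ)
resolve-all {P} cl (φ ∧ ψ) f =
  resolve-all {λ x → P (x ∧ ψ)} (λ χ → cl (∧ˡ χ ψ)) φ λ {a} r →
  resolve-all {λ x → P (a ∧ x)} (λ χ → cl (∧ʳ a χ)) ψ λ s → f (res-∧ r s)
resolve-all {P} cl (φ ∨ ψ) f =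
  resolve-all {λ x → P (x ∨ ψ)} (λ χ → cl (∨ˡ χ ψ)) φ λ {a} r →
  resolve-all {λ x → P (a ∨ x)} (λ χ → cl (∨ʳ a χ)) ψ λ s → f (res-∨ r s)
resolve-all cl (φ ⩔ ψ)  f =
  cl hole (resolve-all cl φ (f ∘ res-⩔ˡ)) (resolve-all cl ψ (f ∘ res-⩔ʳ))

resolve-some : ∀ {P φ a} → ⩔-Closedʳ P → Resolution φ a → P a → P φ
resolve-some cl (res-atom p) t = t
resolve-some cl res-⊥        t = t
resolve-some cl (res-¬ φ)    t = t
resolve-some {P} cl (res-∧ {ψ = ψ} {a = a} r s) t =
  resolve-some {λ x → P (x ∧ ψ)} (λ χ → cl (∧ˡ χ ψ)) r
    (resolve-some {λ x → P (a ∧ x)} (λ χ → cl (∧ʳ a χ)) s t)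
resolve-some {P} cl (res-∨ {ψ = ψ} {a = a} r s) t =
  resolve-some {λ x → P (x ∨ ψ)} (λ χ → cl (∨ˡ χ ψ)) r
    (resolve-some {λ x → P (a ∨ x)} (λ χ → cl (∨ʳ a χ)) s t)
resolve-some cl (res-⩔ˡ r)   t = proj₁ (cl hole) (resolve-some cl r t)
resolve-some cl (res-⩔ʳ r)   t = proj₂ (cl hole) (resolve-some cl r t)

resolve-allˡ : ∀ {Δ} Γ → (∀ {γ} → Resolutions Γ γ → GT γ Δ) → GT Γ Δ
resolve-allˡ {Δ} Γ f =
  subst (λ Γ' → GT Γ' Δ) (++-identityʳ Γ)
    (go Γ λ {γ} rs → subst (λ γ' → GT γ' Δ) (sym (++-identityʳ γ)) (f rs))
  where
  go : ∀ Γ {Θ} → (∀ {γ} → Resolutions Γ γ → GT (γ ++ Θ) Δ) → GT (Γ ++ Θ) Δ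
  go []          f = f []
  go (φ ∷ Γ) {Θ} f = resolve-all {λ x → GT (x ∷ Γ ++ Θ) Δ} L⩔ φ λ {a} r →
    perm (shift a Γ Θ) ↭-refl
      (go Γ λ {γ} rs → perm (↭-sym (shift a γ Θ)) ↭-refl (f (r ∷ rs)))

resolve-someʳ : ∀ {Γ Δ δ} → Resolutions Δ δ → GT Γ δ → GT Γ Δ
resolve-someʳ {Γ} {Δ} {δ} rs d =
  subst (GT Γ) (++-identityʳ Δ) (go rs (subst (GT Γ) (sym (++-identityʳ δ)) d))
  where
  go : ∀ {Δ δ Θ} → Resolutions Δ δ → GT Γ (δ ++ Θ) → GT Γ (Δ ++ Θ)
  go [] d = d
  go {φ ∷ Δ} {a ∷ δ} {Θ} (r ∷ rs) d =
    perm ↭-refl (shift φ Δ Θ)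
      (go rs (perm ↭-refl (↭-sym (shift φ δ Θ)) (resolve-some (λ χ → R⩔ˡ χ , R⩔ʳ χ) r d)))

GT'⇒GT : ∀ {Γ Δ} → All WF Γ → All WF Δ → GT' Γ Δ → GT Γ Δ
GT'⇒GT {Γ} wΓ wΔ d = resolve-allˡ Γ λ rγ →
  let (δ , rδ , h) = GT'-sound d rγ
  in resolve-someʳ rδ
       (GT-complete (resolutions-classical wΓ rγ) (resolutions-classical wΔ rδ) h)

mainTheorem13 : (Γ Δ : List Form) → All WF Γ → All WF Δ → GT Γ Δ ⇔ GT' Γ Δ
mainTheorem13 Γ Δ wΓ wΔ = mk⇔ GT⇒GT' (GT'⇒GT wΓ wΔ)
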